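{- Let $G$ be a connected graph in $\mathcal{G}^{\mathrm{cs}}$ with a cut vertex $v$. Then for each component $D$ of $G-v$, the induced subgraph $G[D\cup\{v\}]$ belongs to $\mathcal{G}^{\mathrm{cs}}$.
   Context: All graphs are finite and simple. A weight function on $V(G)$ is a map $w:V(G)\to\mathbb{R}_{>0}$; for $X\subseteq V(G)$ put $w(X)=\sum_{v\in X}w(v)$. A non-empty set $S\subseteq V(G)$ is a weighted safe set of $(G,w)$ if for every component $C$ of the induced subgraph $G[S]$ and every component $D$ of $G-S$ such that some edge joins $C$ and $D$, we have $w(C)\ge w(D)$. It is a connected weighted safe set if moreover $G[S]$ is connected. $\mathrm{s}(G,w)$ (resp. $\mathrm{cs}(G,w)$) is the minimum of $w(S)$ over all weighted safe sets (resp. connected weighted safe sets) $S$ of $(G,w)$. $\mathcal{G}^{\mathrm{cs}}$ denotes the family of all graphs $G$ such that $\mathrm{s}(G,w)=\mathrm{cs}(G,w)$ for every weight function $w$ on $V(G)$.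
   Formalization: The weight functions defining $\mathcal{G}^{\mathrm{cs}}$ take values in the positive rationals instead of $\mathbb{R}_{>0}$. -}

module Defs where

open import Data.Nat using (ℕ; zero; suc)
open import Data.Bool using (Bool; true; false; T; if_then_else_)
open import Data.Empty using (⊥)
open import Data.Fin using (Fin; zero; suc)
open import Data.Fin.Subset using (Subset; _∈_; _∉_; _⊆_; _∪_; _─_; _-_; ⊤; ⁅_⁆; Nonempty)
open import Data.Vec using ([]; _∷_)
open import Data.Rational using (ℚ; 0ℚ; _+_; _≤_; _<_)
open import Data.Product using (Σ; ∃; ∃-syntax; _×_; _,_)
open import Function using (_∘_)
open import Function.Bundles using (_⇔_)
open import Relation.Binary.PropositionalEquality using (_≡_)
open import Relation.Nullary using (¬_)

record Graph (n : ℕ) : Set where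
  field
    adj    : Fin n → Fin n → Bool
    sym    : ∀ u v → adj u v ≡ adj v u
    irrefl : ∀ u → ¬ T (adj u u)

open Graph public

Edge : ∀ {n} → Graph n → Fin n → Fin n → Set
Edge G u v = T (adj G u v)

-- Everything below is relative to a vertex subset X, i.e. it speaks
-- about the induced subgraph G[X].

data Reach {n} (G : Graph n) (X : Subset n) : Fin n → Fin n → Set where
  here : ∀ {u} → u ∈ X → Reach G X u u
  step : ∀ {u w v} → u ∈ X → Edge G u w → Reach G X w v → Reach G X u v

Connected : ∀ {n} → Graph n → Subset n → Set
Connected G X = Nonempty X × (∀ u v → u ∈ X → v ∈ X → Reach G X u v)

IsComponent : ∀ {n} → Graph n → Subset n → Subset n → Set
IsComponent G X C = ∃[ x ] (x ∈ X × (∀ y → (y ∈ C ⇔ Reach G X x y)))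

Adjacent : ∀ {n} → Graph n → Subset n → Subset n → Set
Adjacent G C D = ∃[ c ] ∃[ d ] (c ∈ C × d ∈ D × Edge G c d)

wsum : ∀ {n} → (Fin n → ℚ) → Subset n → ℚ
wsum w []            = 0ℚ
wsum w (true  ∷ p)   = w zero + wsum (w ∘ suc) p
wsum w (false ∷ p)   = wsum (w ∘ suc) p

-- A weight function on V(G[U]): positive on U (values outside U are
-- irrelevant, since all sets considered are subsets of U).
IsWeight : ∀ {n} → Subset n → (Fin n → ℚ) → Set
IsWeight U w = ∀ v → v ∈ U → 0ℚ < w v

IsSafe : ∀ {n} → Graph n → Subset n → (Fin n → ℚ) → Subset n → Set
IsSafe G U w S =
  S ⊆ U × Nonempty S ×
  (∀ C D → IsComponent G S C → IsComponent G (U ─ S) D →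
           Adjacent G C D → wsum w D ≤ wsum w C)

IsConnSafe : ∀ {n} → Graph n → Subset n → (Fin n → ℚ) → Subset n → Set
IsConnSafe G U w S = IsSafe G U w S × Connected G S

IsSafeNumber : ∀ {n} → Graph n → Subset n → (Fin n → ℚ) → ℚ → Set
IsSafeNumber G U w m =
  (∃[ S ] (IsSafe G U w S × wsum w S ≡ m)) ×
  (∀ S → IsSafe G U w S → m ≤ wsum w S)

IsConnSafeNumber : ∀ {n} → Graph n → Subset n → (Fin n → ℚ) → ℚ → Set
IsConnSafeNumber G U w m =
  (∃[ S ] (IsConnSafe G U w S × wsum w S ≡ m)) ×
  (∀ S → IsConnSafe G U w S → m ≤ wsum w S)

InGcs : ∀ {n} → Graph n → Subset n → Set
InGcs G U = ∀ w → IsWeight U w →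
  ∃[ m ] (IsSafeNumber G U w m × IsConnSafeNumber G U w m)

IsCutVertex : ∀ {n} → Graph n → Fin n → Set
IsCutVertex G v = Nonempty (⊤ - v) × ¬ Connected G (⊤ - v)

{-# OPTIONS --safe #-}

-- Only one property of U = D ∪ {v} matters: every edge leaving U starts at v.
-- Extend positive weights w on U to all of G by giving each vertex outside U
-- a tiny weight ε and lowering w(v) by the total ρ = ε·|V ∖ U| of these.  A
-- safe set S of (G[U], w) then lifts to a safe set of (G, w′) of weight at
-- most w(S) (add all of V ∖ U when v ∈ S), and a connected safe set T of
-- (G, w′) restricts to the connected safe set T ∩ U of (G[U], w), or to U
-- itself when T misses U, of weight at most w′(T) + ρ.  So s = cs on (G, w′)
-- yields a connected safe set of G[U] whose weight exceeds s(G[U], w) by less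
-- than ρ; as ρ lies below every positive difference of two subset sums of w,
-- it is exactly s(G[U], w).

module Submission where

open import Defs
open import Data.Nat as ℕ using (ℕ)
open import Data.Nat.Properties as ℕ using ()
open import Data.Bool using (true; false; T)
open import Data.Bool.Properties using (T?)
open import Data.Empty using (⊥-elim)
open import Data.Fin using (Fin; zero; suc; _≟_)
open import Data.Fin.Properties using (any?)
open import Data.Fin.Subset
  using (Subset; _∈_; _∉_; _⊆_; _⊂_; _∪_; _∩_; _─_; _-_; ∁; ⁅_⁆; ⊤; ∣_∣; Nonempty)
open import Data.Fin.Subset.Properties
  using (_∈?_; ∈⊤; ⊆-antisym; drop-∷-⊆; p⊆p∪q; q⊆p∪q; x∈p∪q⁻; x∈p∩q⁺; p∩q⊆p; p∩q⊆q;
         p─q⊆p; p─⊥≡p; x∈p∧x∉q⇒x∈p─q; x∈⁅x⁆; x∈⁅y⁆⇒x≡y; x∈∁p⇒x∉p; x∉p⇒x∈∁p; x∉∁p⇒x∈p;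
         nonempty?; p⊂q⇒∣p∣<∣q∣; ∣p∣≤n)
open import Data.Vec using ([]; _∷_; here; there)
open import Data.List using (List; []; _∷_; map; _++_; filter; cartesianProductWith)
open import Data.List.Membership.Propositional using () renaming (_∈_ to _∈ˡ_)
open import Data.List.Membership.Propositional.Properties
  using (∈-map⁺; ∈-++⁺ˡ; ∈-++⁺ʳ; ∈-filter⁺; ∈-cartesianProductWith⁺)
open import Data.List.Relation.Unary.All as All using ()
open import Data.List.Relation.Unary.All.Properties using (all-filter)
open import Data.List.Relation.Unary.Any using (here)
open import Data.Rational
  using (ℚ; 0ℚ; 1ℚ; _+_; _*_; -_; 1/_; _≤_; _<_; Positive; NonZero; positive)
  renaming (_-_ to _−_)
open import Data.Rational.Properties as ℚ
  using (≤-refl; ≤-reflexive; <⇒≤; <-irrefl; +-monoʳ-≤; +-monoˡ-≤; +-monoˡ-<;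
         +-identityʳ; +-identityˡ)
open import Data.Rational.Solver using (module +-*-Solver)
open import Algebra.Bundles using (CommutativeMonoid)
open import Algebra.Properties.CommutativeSemigroup
  (CommutativeMonoid.commutativeSemigroup ℚ.+-0-commutativeMonoid) using (x∙yz≈y∙xz)
open import Relation.Binary.Bundles using (DecTotalOrder)
open import Data.Product using (∃-syntax; ∃₂; _×_; _,_; proj₁; proj₂)
open import Data.Sum using (_⊎_; inj₁; inj₂)
open import Function using (_∘_; id)
open import Function.Bundles using (_⇔_; mk⇔; Equivalence)
open import Relation.Binary.PropositionalEquality
  using (_≡_; _≢_; refl; subst; cong; cong₂; trans; module ≡-Reasoning) renaming (sym to ≡-sym)
open import Relation.Nullary using (¬_; Dec; yes; no; does; contradiction; _×-dec_)
open import Relation.Nullary.Decidable using (decidable-stable)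

open Equivalence using (to; from)

private variable
  n : ℕ

x∈p─q⇒x∉q : ∀ {p q : Subset n} {x} → x ∈ p ─ q → x ∉ q
x∈p─q⇒x∉q {p = true ∷ _} {q = false ∷ _} here ()
x∈p─q⇒x∉q {p = _ ∷ _} {q = _ ∷ _} (there x∈p─q) (there x∈q) = x∈p─q⇒x∉q x∈p─q x∈q

⊤─p∩q≡q─p∩q : ∀ (p q : Subset n) → (⊤ ─ p) ∩ q ≡ q ─ (p ∩ q)
⊤─p∩q≡q─p∩q p q = ⊆-antisym
  (λ x∈ → x∈p∧x∉q⇒x∈p─q (p∩q⊆q _ q x∈) (x∈p─q⇒x∉q (p∩q⊆p _ q x∈) ∘ p∩q⊆p p q))
  (λ x∈ → x∈p∩q⁺ (x∈p∧x∉q⇒x∈p─q ∈⊤ (λ x∈p → x∈p─q⇒x∉q x∈ (x∈p∩q⁺ (x∈p , p─q⊆p q _ x∈))) ,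
                  p─q⊆p q _ x∈))

toSubset : ∀ {P : Fin n → Set} → (∀ y → Dec (P y)) → Subset n
toSubset {ℕ.zero}  P? = []
toSubset {ℕ.suc n} P? = does (P? zero) ∷ toSubset (P? ∘ suc)

∈-toSubset : ∀ {P : Fin n → Set} (P? : ∀ y → Dec (P y)) {y} → y ∈ toSubset P? ⇔ P y
∈-toSubset P? {zero} with P? zero
... | yes p = mk⇔ (λ _ → p) (λ _ → here)
... | no ¬p = mk⇔ (λ ()) (λ p → contradiction p ¬p)
∈-toSubset P? {suc y} = mk⇔ (λ { (there y∈) → to (∈-toSubset (P? ∘ suc)) y∈ })
                            (there ∘ from (∈-toSubset (P? ∘ suc)))

module _ (G : Graph n) where

  Edge-sym : ∀ {x y} → Edge G x y → Edge G y x
  Edge-sym {x} {y} = subst T (sym G x y)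

  Reach-source : ∀ {X x y} → Reach G X x y → x ∈ X
  Reach-source (here x∈X)     = x∈X
  Reach-source (step x∈X _ _) = x∈X

  Reach-target : ∀ {X x y} → Reach G X x y → y ∈ X
  Reach-target (here y∈X)   = y∈X
  Reach-target (step _ _ r) = Reach-target r

  Reach-mono : ∀ {X Y x y} → X ⊆ Y → Reach G X x y → Reach G Y x y
  Reach-mono X⊆Y (here x∈X)     = here (X⊆Y x∈X)
  Reach-mono X⊆Y (step x∈X e r) = step (X⊆Y x∈X) e (Reach-mono X⊆Y r)

  Reach-trans : ∀ {X x y z} → Reach G X x y → Reach G X y z → Reach G X x z
  Reach-trans (here _)       s = s
  Reach-trans (step x∈X e r) s = step x∈X e (Reach-trans r s)

  Reach-sym : ∀ {X x y} → Reach G X x y → Reach G X y x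
  Reach-sym (here x∈X)     = here x∈X
  Reach-sym (step x∈X e r) =
    Reach-trans (Reach-sym r) (step (Reach-source r) (Edge-sym e) (here x∈X))

  Reach-lastExit : ∀ {X Y x y} → Reach G X x y → y ∉ Y →
    Reach G (X ─ Y) x y ⊎ ∃₂ λ a b → a ∈ Y × Edge G a b × Reach G (X ─ Y) b y
  Reach-lastExit (here y∈X) y∉Y = inj₁ (here (x∈p∧x∉q⇒x∈p─q y∈X y∉Y))
  Reach-lastExit {Y = Y} {x} (step x∈X e r) y∉Y with Reach-lastExit r y∉Y | x ∈? Y
  ... | inj₂ exit | _       = inj₂ exit
  ... | inj₁ r′   | yes x∈Y = inj₂ (x , _ , x∈Y , e , r′)
  ... | inj₁ r′   | no x∉Y  = inj₁ (step (x∈p∧x∉q⇒x∈p─q x∈X x∉Y) e r′)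

IsComponentOf : Graph n → Subset n → Fin n → Subset n → Set
IsComponentOf G X x C = ∀ y → y ∈ C ⇔ Reach G X x y

module _ {G : Graph n} {X : Subset n} where

  componentOf-⊆ : ∀ {x C} → IsComponentOf G X x C → C ⊆ X
  componentOf-⊆ C-x {y} y∈C = Reach-target G (to (C-x y) y∈C)

  componentOf-∋ : ∀ {x C} → IsComponentOf G X x C → x ∈ X → x ∈ C
  componentOf-∋ {x} C-x x∈X = from (C-x x) (here x∈X)

  componentOf-reroot : ∀ {x c C} → IsComponentOf G X x C → c ∈ C → IsComponentOf G X c C
  componentOf-reroot {c = c} C-x c∈C y = mk⇔
    (λ y∈C → Reach-trans G (Reach-sym G (to (C-x c) c∈C)) (to (C-x y) y∈C))
    (λ r → from (C-x y) (Reach-trans G (to (C-x c) c∈C) r))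

  component⇒componentOf : ∀ {c C} → IsComponent G X C → c ∈ C → IsComponentOf G X c C
  component⇒componentOf (_ , _ , C-x) = componentOf-reroot C-x

  componentOf-unique : ∀ {x C C′} → IsComponentOf G X x C → IsComponentOf G X x C′ → C ≡ C′
  componentOf-unique C-x C′-x =
    ⊆-antisym (λ {y} → from (C′-x y) ∘ to (C-x y)) (λ {y} → from (C-x y) ∘ to (C′-x y))

  connected⇒componentOf : ∀ {x} → Connected G X → x ∈ X → IsComponentOf G X x X
  connected⇒componentOf (_ , reach) x∈X y = mk⇔ (reach _ y x∈X) (Reach-target G)

connected⇒component : ∀ {G : Graph n} {X} → Connected G X → IsComponent G X X
connected⇒component X-conn@((x , x∈X) , _) = x , x∈X , connected⇒componentOf X-conn x∈X

connected⇒adjacent : ∀ {G : Graph n} {Y Z} → Connected G ⊤ → Nonempty Y →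
  IsComponent G (⊤ ─ Y) Z → Adjacent G Y Z
connected⇒adjacent {G = G} (_ , reach) (y , y∈Y) (z , z∈⊤─Y , Z-z)
  with Reach-lastExit G (reach y z ∈⊤ ∈⊤) (x∈p─q⇒x∉q z∈⊤─Y)
... | inj₁ r = contradiction y∈Y (x∈p─q⇒x∉q (Reach-source G r))
... | inj₂ (a , b , a∈Y , e , r) = a , b , a∈Y , from (Z-z b) (Reach-sym G r) , e

module _ (G : Graph n) (X : Subset n) (x : Fin n) where

  private
    grow : Subset n → Subset n
    grow Z = Z ∪ toSubset (λ y → y ∈? X ×-dec any? (λ z → z ∈? Z ×-dec T? (adj G z y)))

    Reached : Subset n → Set
    Reached Z = x ∈ Z × (∀ {y} → y ∈ Z → Reach G X x y)

    Closed : Subset n → Set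
    Closed Z = ∀ {z y} → z ∈ Z → y ∈ X → Edge G z y → y ∈ Z

    grow-reached : ∀ {Z} → Reached Z → Reached (grow Z)
    grow-reached {Z} (x∈Z , reach) = p⊆p∪q _ x∈Z , reach′
      where
      reach′ : ∀ {y} → y ∈ grow Z → Reach G X x y
      reach′ y∈ with x∈p∪q⁻ Z _ y∈
      ... | inj₁ y∈Z = reach y∈Z
      ... | inj₂ y∈new with to (∈-toSubset _) y∈new
      ...   | y∈X , _ , z∈Z , e =
        Reach-trans G (reach z∈Z) (step (Reach-target G (reach z∈Z)) e (here y∈X))

    closed-or-grows : ∀ Z → Closed Z ⊎ Z ⊂ grow Z
    closed-or-grows Z with nonempty? (grow Z ─ Z)
    ... | yes (y , y∈) = inj₂ (p⊆p∪q _ , y , p─q⊆p _ _ y∈ , x∈p─q⇒x∉q y∈)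
    ... | no nothing-new = inj₁ closed
      where
      closed : Closed Z
      closed {z} {y} z∈Z y∈X e with y ∈? Z
      ... | yes y∈Z = y∈Z
      ... | no y∉Z = contradiction (y , x∈p∧x∉q⇒x∈p─q new y∉Z) nothing-new
        where new = q⊆p∪q Z _ (from (∈-toSubset _) (y∈X , z , z∈Z , e))

    -- Each round that does not close Z enlarges it, so fuel k with n ≤ ∣ Z ∣ + k suffices.
    search : ∀ k Z → Reached Z → n ℕ.≤ ∣ Z ∣ ℕ.+ k → ∃[ C ] (Reached C × Closed C)
    search k Z reached bound with closed-or-grows Z
    ... | inj₁ closed = Z , reached , closed
    search ℕ.zero Z _ bound | inj₂ Z⊂ = contradiction
      (ℕ.≤-trans (∣p∣≤n (grow Z)) (ℕ.≤-trans bound (ℕ.≤-reflexive (ℕ.+-identityʳ _))))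
      (ℕ.<⇒≱ (p⊂q⇒∣p∣<∣q∣ Z⊂))
    search (ℕ.suc k) Z reached bound | inj₂ Z⊂ = search k (grow Z) (grow-reached reached)
      (ℕ.≤-trans bound (ℕ.≤-trans (ℕ.≤-reflexive (ℕ.+-suc _ k)) (ℕ.+-monoˡ-≤ k (p⊂q⇒∣p∣<∣q∣ Z⊂))))

  componentOf-exists : x ∈ X → ∃[ C ] IsComponentOf G X x C
  componentOf-exists x∈X with search n ⁅ x ⁆ (x∈⁅x⁆ x , start) (ℕ.m≤n+m n _)
    where
    start : ∀ {y} → y ∈ ⁅ x ⁆ → Reach G X x y
    start y∈ = subst (Reach G X x) (≡-sym (x∈⁅y⁆⇒x≡y x y∈)) (here x∈X)
  ... | C , (x∈C , reach) , closed = C , λ y → mk⇔ reach (close x∈C)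
    where
    close : ∀ {a y} → a ∈ C → Reach G X a y → y ∈ C
    close a∈C (here _)     = a∈C
    close a∈C (step _ e r) = close (closed a∈C (Reach-source G r) e) r

0≤p⇒q≤p+q : ∀ {p q} → 0ℚ ≤ p → q ≤ p + q
0≤p⇒q≤p+q {p} {q} p≥0 = subst (_≤ p + q) (+-identityˡ q) (+-monoˡ-≤ q p≥0)

0≤p⇒q≤q+p : ∀ {p q} → 0ℚ ≤ p → q ≤ q + p
0≤p⇒q≤q+p {p} {q} p≥0 = subst (_≤ q + p) (+-identityʳ q) (+-monoʳ-≤ q p≥0)

p<q⇒0<q−p : ∀ {p q} → p < q → 0ℚ < q − p
p<q⇒0<q−p {p} {q} p<q = subst (_< q − p) (ℚ.+-inverseʳ p) (+-monoˡ-< (- p) p<q)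

p≤q+r⇒p−q≤r : ∀ {p q r} → p ≤ q + r → p − q ≤ r
p≤q+r⇒p−q≤r {p} {q} {r} p≤q+r = subst (p − q ≤_) (solve 2 (λ q r → q :+ r :- q := r) refl q r)
                                         (+-monoˡ-≤ (- q) p≤q+r)
  where open +-*-Solver

wsum-cong : ∀ {f g : Fin n → ℚ} X → (∀ {x} → x ∈ X → f x ≡ g x) → wsum f X ≡ wsum g X
wsum-cong []          _   = refl
wsum-cong (true  ∷ X) f≡g = cong₂ _+_ (f≡g here) (wsum-cong X (f≡g ∘ there))
wsum-cong (false ∷ X) f≡g = wsum-cong X (f≡g ∘ there)

wsum-split : ∀ (f : Fin n → ℚ) (X Y : Subset n) → wsum f X ≡ wsum f (X ∩ Y) + wsum f (X ─ Y)
wsum-split f []          []          = ≡-sym (+-identityʳ 0ℚ)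
wsum-split f (false ∷ X) (true  ∷ Y) = wsum-split (f ∘ suc) X Y
wsum-split f (false ∷ X) (false ∷ Y) = wsum-split (f ∘ suc) X Y
wsum-split f (true  ∷ X) (true  ∷ Y) = trans (cong (f zero +_) (wsum-split (f ∘ suc) X Y))
  (≡-sym (ℚ.+-assoc (f zero) (wsum (f ∘ suc) (X ∩ Y)) (wsum (f ∘ suc) (X ─ Y))))
wsum-split f (true  ∷ X) (false ∷ Y) = trans (cong (f zero +_) (wsum-split (f ∘ suc) X Y))
  (x∙yz≈y∙xz (f zero) (wsum (f ∘ suc) (X ∩ Y)) (wsum (f ∘ suc) (X ─ Y)))

wsum-nonneg : ∀ (f : Fin n → ℚ) (X : Subset n) → (∀ {x} → x ∈ X → 0ℚ ≤ f x) → 0ℚ ≤ wsum f X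
wsum-nonneg f []          _   = ≤-refl
wsum-nonneg f (true  ∷ X) f≥0 =
  ℚ.+-mono-≤ (f≥0 here) (wsum-nonneg (f ∘ suc) X (f≥0 ∘ there))
wsum-nonneg f (false ∷ X) f≥0 = wsum-nonneg (f ∘ suc) X (f≥0 ∘ there)

wsum-mono : ∀ (f : Fin n → ℚ) {X Y : Subset n} → (∀ {x} → x ∈ Y → 0ℚ ≤ f x) →
            X ⊆ Y → wsum f X ≤ wsum f Y
wsum-mono f {[]}        {[]}        _   _   = ≤-refl
wsum-mono f {true  ∷ X} {true  ∷ Y} f≥0 X⊆Y =
  +-monoʳ-≤ (f zero) (wsum-mono (f ∘ suc) (f≥0 ∘ there) (drop-∷-⊆ X⊆Y))
wsum-mono f {true  ∷ X} {false ∷ Y} _   X⊆Y with () ← X⊆Y here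
wsum-mono f {false ∷ X} {true  ∷ Y} f≥0 X⊆Y =
  ℚ.≤-trans (wsum-mono (f ∘ suc) (f≥0 ∘ there) (drop-∷-⊆ X⊆Y)) (0≤p⇒q≤p+q (f≥0 here))
wsum-mono f {false ∷ X} {false ∷ Y} f≥0 X⊆Y =
  wsum-mono (f ∘ suc) (f≥0 ∘ there) (drop-∷-⊆ X⊆Y)

wsum-remove : ∀ (f : Fin n → ℚ) {X : Subset n} {v} → v ∈ X → wsum f X ≡ f v + wsum f (X - v)
wsum-remove f {true ∷ X} here = cong (λ Y → f zero + wsum (f ∘ suc) Y) (≡-sym (p─⊥≡p X))
wsum-remove f {true ∷ X} {suc v} (there v∈X) =
  trans (cong (f zero +_) (wsum-remove (f ∘ suc) v∈X))
        (x∙yz≈y∙xz (f zero) (f (suc v)) (wsum (f ∘ suc) (X - v)))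
wsum-remove f {false ∷ X} (there v∈X) = wsum-remove (f ∘ suc) v∈X

wsum-const : ∀ (c : ℚ) (X : Subset n) → wsum (λ _ → c) X ≡ c * wsum (λ _ → 1ℚ) X
wsum-const c []          = ≡-sym (ℚ.*-zeroʳ c)
wsum-const c (true  ∷ X) = trans (cong (c +_) (wsum-const c X))
  (≡-sym (trans (ℚ.*-distribˡ-+ c 1ℚ k) (cong (_+ c * k) (ℚ.*-identityʳ c))))
  where k = wsum (λ _ → 1ℚ) X
wsum-const c (false ∷ X) = wsum-const c X

allSubsets : ∀ n → List (Subset n)
allSubsets ℕ.zero    = [] ∷ []
allSubsets (ℕ.suc n) = map (true ∷_) (allSubsets n) ++ map (false ∷_) (allSubsets n)

∈-allSubsets : ∀ (X : Subset n) → X ∈ˡ allSubsets n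
∈-allSubsets []          = here refl
∈-allSubsets (true  ∷ X) = ∈-++⁺ˡ (∈-map⁺ (true ∷_) (∈-allSubsets X))
∈-allSubsets {ℕ.suc n} (false ∷ X) =
  ∈-++⁺ʳ (map (true ∷_) (allSubsets n)) (∈-map⁺ (false ∷_) (∈-allSubsets X))

wsum-gap : ∀ (w : Fin n → ℚ) {d} → 0ℚ < d → ∃[ δ ] (0ℚ < δ × δ ≤ d ×
  (∀ {ρ} → ρ < δ → ∀ A B → wsum w A ≤ wsum w B + ρ → wsum w A ≤ wsum w B))
wsum-gap {n} w {d} d>0 =
  min d gaps , argmin-all id d>0 (all-filter (0ℚ ℚ.<?_) differences) , min≤⊤ d gaps , absorb
  where
  open import Data.List.Extrema (DecTotalOrder.totalOrder ℚ.≤-decTotalOrder)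
    using (min; min≤⊤; min≤xs; argmin-all)
  sums        = map (wsum w) (allSubsets n)
  differences = cartesianProductWith _−_ sums sums
  gaps        = filter (0ℚ ℚ.<?_) differences
  gap≤ : ∀ A B → wsum w B < wsum w A → min d gaps ≤ wsum w A − wsum w B
  gap≤ A B B<A = All.lookup (min≤xs d gaps) (∈-filter⁺ (0ℚ ℚ.<?_)
    (∈-cartesianProductWith⁺ _−_ (∈-map⁺ (wsum w) (∈-allSubsets A))
                                 (∈-map⁺ (wsum w) (∈-allSubsets B)))
    (p<q⇒0<q−p B<A))
  absorb : ∀ {ρ} → ρ < min d gaps → ∀ A B → wsum w A ≤ wsum w B + ρ → wsum w A ≤ wsum w B
  absorb ρ<δ A B A≤B+ρ with wsum w A ℚ.≤? wsum w B
  ... | yes A≤B = A≤B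
  ... | no A≰B  = ⊥-elim (<-irrefl refl
    (ℚ.≤-<-trans (gap≤ A B (ℚ.≰⇒> A≰B)) (ℚ.≤-<-trans (p≤q+r⇒p−q≤r A≤B+ρ) ρ<δ)))

uniform-weight< : ∀ (X : Subset n) {δ} → 0ℚ < δ → ∃[ ε ] (0ℚ < ε × wsum (λ _ → ε) X < δ)
uniform-weight< X {δ} δ>0 = ε , ℚ.positive⁻¹ ε , (begin-strict
  wsum (λ _ → ε) X   ≡⟨ wsum-const ε X ⟩
  ε * k              ≡⟨ cong (ε *_) (+-identityˡ k) ⟨
  ε * (0ℚ + k)       <⟨ ℚ.*-monoʳ-<-pos ε (+-monoˡ-< k (ℚ.positive⁻¹ 1ℚ)) ⟩
  ε * (1ℚ + k)       ≡⟨ ℚ.*-assoc δ (1/ (1ℚ + k)) (1ℚ + k) ⟩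
  δ * (1/ (1ℚ + k) * (1ℚ + k)) ≡⟨ cong (δ *_) (ℚ.*-inverseˡ (1ℚ + k)) ⟩
  δ * 1ℚ             ≡⟨ ℚ.*-identityʳ δ ⟩
  δ                  ∎)
  where
  open ℚ.≤-Reasoning
  k = wsum (λ _ → 1ℚ) X
  instance
    δ-pos : Positive δ
    δ-pos = positive δ>0
    1+k-pos : Positive (1ℚ + k)
    1+k-pos = positive (ℚ.<-≤-trans (ℚ.positive⁻¹ 1ℚ)
                                    (0≤p⇒q≤q+p (wsum-nonneg _ X (λ _ → <⇒≤ (ℚ.positive⁻¹ 1ℚ)))))
    1+k-nonZero : NonZero (1ℚ + k)
    1+k-nonZero = ℚ.pos⇒nonZero (1ℚ + k)
    1/[1+k]-pos : Positive (1/ (1ℚ + k))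
    1/[1+k]-pos = ℚ.1/pos⇒pos (1ℚ + k)
  ε = δ * 1/ (1ℚ + k)
  instance
    ε-pos : Positive ε
    ε-pos = ℚ.pos*pos⇒pos δ (1/ (1ℚ + k))

connected⇒connSafe : ∀ {G : Graph n} {U} (w : Fin n → ℚ) → Connected G U → IsConnSafe G U w U
connected⇒connSafe {G = G} {U} w U-conn@(U-ne , _) =
  ((λ u∈U → u∈U) , U-ne , nothing-outside) , U-conn
  where
  nothing-outside : ∀ C D → IsComponent G U C → IsComponent G (U ─ U) D → Adjacent G C D →
                    wsum w D ≤ wsum w C
  nothing-outside _ _ _ (_ , d∈U─U , _) _ = contradiction (p─q⊆p U U d∈U─U) (x∈p─q⇒x∉q d∈U─U)

minimal-connSafe⇒s≡cs : ∀ {G : Graph n} {U w T} → IsConnSafe G U w T →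
  (∀ S → IsSafe G U w S → wsum w T ≤ wsum w S) →
  ∃[ m ] (IsSafeNumber G U w m × IsConnSafeNumber G U w m)
minimal-connSafe⇒s≡cs {T = T} T-cs T-min = _ ,
  ((T , proj₁ T-cs , refl) , T-min) , ((T , T-cs , refl) , λ S S-cs → T-min S (proj₁ S-cs))

AttachedAt : Graph n → Subset n → Fin n → Set
AttachedAt G U v = ∀ {x y} → x ∈ U → y ∉ U → Edge G x y → x ≡ v

component∪⁅v⁆-attached : ∀ {G : Graph n} {v D} → IsComponent G (⊤ - v) D →
                         AttachedAt G (D ∪ ⁅ v ⁆) v
component∪⁅v⁆-attached {G = G} {v} {D} D-comp {x} {y} x∈ y∉ e with x∈p∪q⁻ D ⁅ v ⁆ x∈
... | inj₂ x∈⁅v⁆ = x∈⁅y⁆⇒x≡y v x∈⁅v⁆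
... | inj₁ x∈D = contradiction (p⊆p∪q ⁅ v ⁆ (from (D-x y) (step x∈⊤-v e (here y∈⊤-v)))) y∉
  where
  D-x = component⇒componentOf D-comp x∈D
  x∈⊤-v = componentOf-⊆ D-x x∈D
  y∈⊤-v = x∈p∧x∉q⇒x∈p─q ∈⊤ (y∉ ∘ q⊆p∪q D ⁅ v ⁆)

attached-∁∪⁅v⁆ : ∀ {G : Graph n} {U v} → AttachedAt G U v → AttachedAt G (∁ U ∪ ⁅ v ⁆) v
attached-∁∪⁅v⁆ {G = G} {U} {v} attached {x} {y} x∈ y∉ e with x∈p∪q⁻ (∁ U) ⁅ v ⁆ x∈
... | inj₂ x∈⁅v⁆ = x∈⁅y⁆⇒x≡y v x∈⁅v⁆
... | inj₁ x∈∁U = contradiction (q⊆p∪q (∁ U) ⁅ v ⁆ (subst (_∈ ⁅ v ⁆) (≡-sym y≡v) (x∈⁅x⁆ v))) y∉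
  where
  y≡v = attached (x∉∁p⇒x∈p (y∉ ∘ p⊆p∪q ⁅ v ⁆)) (x∈∁p⇒x∉p x∈∁U) (Edge-sym G e)

module _ {G : Graph n} {U v} (attached : AttachedAt G U v) where

  -- A walk can leave U only from v and re-enter U only at v, so every excursion
  -- outside U can be cut out.
  Reach-∩ : ∀ {X a b} → Reach G X a b → a ∈ U → b ∈ U → Reach G (X ∩ U) a b
  Reach-reenter : ∀ {X a b} → Reach G X a b → a ∉ U → b ∈ U → Reach G (X ∩ U) v b

  Reach-∩ (here a∈X) a∈U _ = here (x∈p∩q⁺ (a∈X , a∈U))
  Reach-∩ {X} {b = b} (step {w = c} a∈X e r) a∈U b∈U with c ∈? U
  ... | yes c∈U = step (x∈p∩q⁺ (a∈X , a∈U)) e (Reach-∩ r c∈U b∈U)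
  ... | no c∉U  = subst (λ z → Reach G (X ∩ U) z b) (≡-sym (attached a∈U c∉U e))
                        (Reach-reenter r c∉U b∈U)

  Reach-reenter (here _) a∉U b∈U = contradiction b∈U a∉U
  Reach-reenter {X} {b = b} (step {w = c} _ e r) a∉U b∈U with c ∈? U
  ... | yes c∈U = subst (λ z → Reach G (X ∩ U) z b) (attached c∈U a∉U (Edge-sym G e))
                        (Reach-∩ r c∈U b∈U)
  ... | no c∉U  = Reach-reenter r c∉U b∈U

  Reach-exit : ∀ {X a y} → Reach G X a y → a ∈ U → y ∉ U → Reach G X a v
  Reach-exit (here _) a∈U y∉U = contradiction a∈U y∉U
  Reach-exit {X} {a} (step {w = c} a∈X e r) a∈U y∉U with c ∈? U
  ... | yes c∈U = step a∈X e (Reach-exit r c∈U y∉U)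
  ... | no c∉U  = subst (Reach G X a) (attached a∈U c∉U e) (here a∈X)

  connected-∩ : ∀ {X} → Connected G X → Nonempty (X ∩ U) → Connected G (X ∩ U)
  connected-∩ {X} (_ , reach) X∩U-ne = X∩U-ne , λ a b a∈ b∈ →
    Reach-∩ (reach a b (p∩q⊆p X U a∈) (p∩q⊆p X U b∈)) (p∩q⊆q X U a∈) (p∩q⊆q X U b∈)

  componentOf-∩ : ∀ {X x C} → IsComponentOf G X x C → x ∈ U → IsComponentOf G (X ∩ U) x (C ∩ U)
  componentOf-∩ {X} {C = C} C-x x∈U y = mk⇔
    (λ y∈ → Reach-∩ (to (C-x y) (p∩q⊆p C U y∈)) x∈U (p∩q⊆q C U y∈))
    (λ r → x∈p∩q⁺ (from (C-x y) (Reach-mono G (p∩q⊆p X U) r) , p∩q⊆q X U (Reach-target G r)))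

  componentOf-exit : ∀ {X x C y} → IsComponentOf G X x C → x ∈ U → y ∈ C → y ∉ U → v ∈ C
  componentOf-exit C-x x∈U y∈C y∉U = from (C-x _) (Reach-exit (to (C-x _) y∈C) x∈U y∉U)

Reach-within : ∀ {G : Graph n} {U v a b} → Connected G ⊤ → AttachedAt G U v →
               a ∈ U → b ∈ U → Reach G U a b
Reach-within {G = G} {U} (_ , reach) attached a∈U b∈U =
  Reach-mono G (p∩q⊆q ⊤ U) (Reach-∩ attached (reach _ _ ∈⊤ ∈⊤) a∈U b∈U)

connected-attached : ∀ {G : Graph n} {U v} → Connected G ⊤ → AttachedAt G U v → v ∈ U →
                     Connected G U
connected-attached {v = v} G-conn attached v∈U = (v , v∈U) , λ _ _ → Reach-within G-conn attached

-- ∁ U ∪ {v} is attached at v too, so v reaches every vertex outside U without entering U.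
componentOf-∁ : ∀ {G : Graph n} {U v X x C} → Connected G ⊤ → AttachedAt G U v →
                IsComponentOf G X x C → v ∈ C → ∁ U ⊆ X → ∁ U ⊆ C
componentOf-∁ {G = G} {U} {v} {X} G-conn attached C-x v∈C ∁U⊆X {r} r∈∁U =
  from (componentOf-reroot C-x v∈C r) (Reach-mono G ∁U∪v⊆X
    (Reach-within G-conn (attached-∁∪⁅v⁆ {G = G} {U} {v} attached)
                  (q⊆p∪q (∁ U) ⁅ v ⁆ (x∈⁅x⁆ v)) (p⊆p∪q ⁅ v ⁆ r∈∁U)))
  where
  ∁U∪v⊆X : ∁ U ∪ ⁅ v ⁆ ⊆ X
  ∁U∪v⊆X y∈ with x∈p∪q⁻ (∁ U) ⁅ v ⁆ y∈
  ... | inj₁ y∈∁U  = ∁U⊆X y∈∁U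
  ... | inj₂ y∈⁅v⁆ = subst (_∈ X) (≡-sym (x∈⁅y⁆⇒x≡y v y∈⁅v⁆)) (componentOf-⊆ C-x v∈C)

module Perturbation {U : Subset n} {v : Fin n} (v∈U : v ∈ U) (w : Fin n → ℚ) (w>0 : IsWeight U w)
                    {ε : ℚ} (ε>0 : 0ℚ < ε) (ρ<wv : wsum (λ _ → ε) (∁ U) < w v) where

  ρ : ℚ
  ρ = wsum (λ _ → ε) (∁ U)

  -- Lowering w(v) by ρ makes w′(X) = w(X ∩ U) whenever X contains v and all of ∁ U.
  w′ : Fin n → ℚ
  w′ x with x ∈? U | x ≟ v
  ... | no _  | _     = ε
  ... | yes _ | yes _ = w v − ρ
  ... | yes _ | no _  = w x

  w′-outside : ∀ {x} → x ∉ U → w′ x ≡ ε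
  w′-outside {x} x∉U with x ∈? U | x ≟ v
  ... | no _    | _ = refl
  ... | yes x∈U | _ = contradiction x∈U x∉U

  w′-v : w′ v ≡ w v − ρ
  w′-v with v ∈? U | v ≟ v
  ... | yes _  | yes _  = refl
  ... | yes _  | no v≢v = contradiction refl v≢v
  ... | no v∉U | _      = contradiction v∈U v∉U

  w′-inside : ∀ {x} → x ∈ U → x ≢ v → w′ x ≡ w x
  w′-inside {x} x∈U x≢v with x ∈? U | x ≟ v
  ... | yes _  | no _    = refl
  ... | yes _  | yes x≡v = contradiction x≡v x≢v
  ... | no x∉U | _       = contradiction x∈U x∉U

  w′>0 : ∀ x → 0ℚ < w′ x
  w′>0 x with x ∈? U | x ≟ v
  ... | no _    | _     = ε>0
  ... | yes _   | yes _ = p<q⇒0<q−p ρ<wv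
  ... | yes x∈U | no _  = w>0 x x∈U

  w′≥0 : ∀ {X x} → x ∈ X → 0ℚ ≤ w′ x
  w′≥0 {x = x} _ = <⇒≤ (w′>0 x)

  ρ≥0 : 0ℚ ≤ ρ
  ρ≥0 = wsum-nonneg _ (∁ U) (λ _ → <⇒≤ ε>0)

  wsum-w′-∉ : ∀ {X} → X ⊆ U → v ∉ X → wsum w′ X ≡ wsum w X
  wsum-w′-∉ {X} X⊆U v∉X = wsum-cong X λ x∈X →
    w′-inside (X⊆U x∈X) (λ x≡v → v∉X (subst (_∈ X) x≡v x∈X))

  wsum-w′-∈ : ∀ {X} → X ⊆ U → v ∈ X → wsum w′ X + ρ ≡ wsum w X
  wsum-w′-∈ {X} X⊆U v∈X = begin
    wsum w′ X + ρ                   ≡⟨ cong (_+ ρ) (wsum-remove w′ v∈X) ⟩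
    w′ v + wsum w′ (X - v) + ρ      ≡⟨ cong₂ (λ a b → a + b + ρ) w′-v (wsum-w′-∉ X-v⊆U v∉X-v) ⟩
    (w v − ρ) + wsum w (X - v) + ρ  ≡⟨ solve 3 (λ a b c → a :- c :+ b :+ c := a :+ b) refl
                                               (w v) (wsum w (X - v)) ρ ⟩
    w v + wsum w (X - v)            ≡⟨ wsum-remove w v∈X ⟨
    wsum w X                        ∎
    where
    open ≡-Reasoning
    open +-*-Solver
    X-v⊆U : X - v ⊆ U
    X-v⊆U = X⊆U ∘ p─q⊆p X ⁅ v ⁆
    v∉X-v : v ∉ X - v
    v∉X-v v∈ = x∈p─q⇒x∉q v∈ (x∈⁅x⁆ v)

  wsum-w′-∁ : wsum w′ (∁ U) ≡ ρ
  wsum-w′-∁ = wsum-cong (∁ U) (w′-outside ∘ x∈∁p⇒x∉p)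

  wsum-w′-outside≤ρ : ∀ X → wsum w′ (X ─ U) ≤ ρ
  wsum-w′-outside≤ρ X =
    ℚ.≤-trans (wsum-mono w′ {X ─ U} {∁ U} w′≥0 (x∉p⇒x∈∁p ∘ x∈p─q⇒x∉q)) (≤-reflexive wsum-w′-∁)

  wsum-w′-outside≡ρ : ∀ {X} → ∁ U ⊆ X → wsum w′ (X ─ U) ≡ ρ
  wsum-w′-outside≡ρ {X} ∁U⊆X = trans (cong (wsum w′) X─U≡∁U) wsum-w′-∁
    where
    X─U≡∁U : X ─ U ≡ ∁ U
    X─U≡∁U = ⊆-antisym (x∉p⇒x∈∁p ∘ x∈p─q⇒x∉q)
                       (λ x∈∁U → x∈p∧x∉q⇒x∈p─q (∁U⊆X x∈∁U) (x∈∁p⇒x∉p x∈∁U))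

  w∩U≤w′ : ∀ X → (v ∈ X → ∁ U ⊆ X) → wsum w (X ∩ U) ≤ wsum w′ X
  w∩U≤w′ X full with v ∈? X
  ... | yes v∈X = ≤-reflexive (begin-equality
    wsum w (X ∩ U)                     ≡⟨ wsum-w′-∈ (p∩q⊆q X U) (x∈p∩q⁺ (v∈X , v∈U)) ⟨
    wsum w′ (X ∩ U) + ρ                ≡⟨ cong (wsum w′ (X ∩ U) +_) (wsum-w′-outside≡ρ (full v∈X)) ⟨
    wsum w′ (X ∩ U) + wsum w′ (X ─ U)  ≡⟨ wsum-split w′ X U ⟨
    wsum w′ X                          ∎)
    where open ℚ.≤-Reasoning
  ... | no v∉X = begin
    wsum w (X ∩ U)    ≡⟨ wsum-w′-∉ (p∩q⊆q X U) (v∉X ∘ p∩q⊆p X U) ⟨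
    wsum w′ (X ∩ U)   ≤⟨ wsum-mono w′ w′≥0 (p∩q⊆p X U) ⟩
    wsum w′ X         ∎
    where open ℚ.≤-Reasoning

  w∩U≤w′+ρ : ∀ X → wsum w (X ∩ U) ≤ wsum w′ X + ρ
  w∩U≤w′+ρ X with v ∈? X
  ... | yes v∈X = begin
    wsum w (X ∩ U)        ≡⟨ wsum-w′-∈ (p∩q⊆q X U) (x∈p∩q⁺ (v∈X , v∈U)) ⟨
    wsum w′ (X ∩ U) + ρ   ≤⟨ +-monoˡ-≤ ρ (wsum-mono w′ w′≥0 (p∩q⊆p X U)) ⟩
    wsum w′ X + ρ         ∎
    where open ℚ.≤-Reasoning
  ... | no v∉X = begin
    wsum w (X ∩ U)    ≤⟨ w∩U≤w′ X (λ v∈X → contradiction v∈X v∉X) ⟩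
    wsum w′ X         ≤⟨ 0≤p⇒q≤q+p ρ≥0 ⟩
    wsum w′ X + ρ     ∎
    where open ℚ.≤-Reasoning

  w′≤w∩U : ∀ X → (∀ {y} → y ∈ X → y ∉ U → v ∈ X) → wsum w′ X ≤ wsum w (X ∩ U)
  w′≤w∩U X meets with v ∈? X
  ... | yes v∈X = begin
    wsum w′ X                           ≡⟨ wsum-split w′ X U ⟩
    wsum w′ (X ∩ U) + wsum w′ (X ─ U)   ≤⟨ +-monoʳ-≤ (wsum w′ (X ∩ U)) (wsum-w′-outside≤ρ X) ⟩
    wsum w′ (X ∩ U) + ρ                 ≡⟨ wsum-w′-∈ (p∩q⊆q X U) (x∈p∩q⁺ (v∈X , v∈U)) ⟩
    wsum w (X ∩ U)                      ∎
    where open ℚ.≤-Reasoning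
  ... | no v∉X = ≤-reflexive (begin-equality
    wsum w′ X         ≡⟨ cong (wsum w′) X∩U≡X ⟨
    wsum w′ (X ∩ U)   ≡⟨ wsum-w′-∉ (p∩q⊆q X U) (v∉X ∘ p∩q⊆p X U) ⟩
    wsum w (X ∩ U)    ∎)
    where
    open ℚ.≤-Reasoning
    X∩U≡X : X ∩ U ≡ X
    X∩U≡X = ⊆-antisym (p∩q⊆p X U) λ {y} y∈X →
      x∈p∩q⁺ (y∈X , decidable-stable (y ∈? U) (v∉X ∘ meets y∈X))

module Transfer {G : Graph n} (G-conn : Connected G ⊤) {U v} (attached : AttachedAt G U v)
                (v∈U : v ∈ U) (w : Fin n → ℚ) (w>0 : IsWeight U w)
                {ε : ℚ} (ε>0 : 0ℚ < ε) (ρ<wv : wsum (λ _ → ε) (∁ U) < w v) where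

  open Perturbation v∈U w w>0 ε>0 ρ<wv

  crossing-edge-inside : ∀ {S′ c d} → (v ∈ S′ → ∁ U ⊆ S′) → (∀ {y} → y ∈ S′ → y ∉ U → v ∈ S′) →
                         c ∈ S′ → d ∉ S′ → Edge G c d → c ∈ U × d ∈ U
  crossing-edge-inside {S′} {c} {d} full meets c∈S′ d∉S′ e = c∈U , d∈U
    where
    v∈S′⇒d∈U : v ∈ S′ → d ∈ U
    v∈S′⇒d∈U v∈S′ = x∉∁p⇒x∈p (d∉S′ ∘ full v∈S′)
    c∈U : c ∈ U
    c∈U = decidable-stable (c ∈? U) λ c∉U →
      let v∈S′ = meets c∈S′ c∉U in
      d∉S′ (subst (_∈ S′) (≡-sym (attached (v∈S′⇒d∈U v∈S′) c∉U (Edge-sym G e))) v∈S′)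
    d∈U : d ∈ U
    d∈U = decidable-stable (d ∈? U) λ d∉U →
      d∉U (v∈S′⇒d∈U (subst (_∈ S′) (attached c∈U d∉U e) c∈S′))

  lift-safe-saturated : ∀ {S S′} → S′ ∩ U ≡ S →
    (v ∈ S′ → ∁ U ⊆ S′) → (∀ {y} → y ∈ S′ → y ∉ U → v ∈ S′) →
    IsSafe G U w S → IsSafe G ⊤ w′ S′ × wsum w′ S′ ≤ wsum w S
  lift-safe-saturated {S} {S′} S′∩U≡S full meets (_ , (s , s∈S) , S-safe) =
    ((λ _ → ∈⊤) , (s , p∩q⊆p S′ U (subst (s ∈_) (≡-sym S′∩U≡S) s∈S)) , S′-safe) ,
    subst (λ X → wsum w′ S′ ≤ wsum w X) S′∩U≡S (w′≤w∩U S′ meets)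
    where
    S′-safe : ∀ C′ D′ → IsComponent G S′ C′ → IsComponent G (⊤ ─ S′) D′ → Adjacent G C′ D′ →
              wsum w′ D′ ≤ wsum w′ C′
    S′-safe C′ D′ C′-comp D′-comp (c , d , c∈C′ , d∈D′ , e) = begin
      wsum w′ D′        ≤⟨ w′≤w∩U D′ (componentOf-exit attached D′-d d∈U) ⟩
      wsum w (D′ ∩ U)   ≤⟨ S-safe (C′ ∩ U) (D′ ∩ U) (c , c∈S , C′∩U-c)
                                  (d , componentOf-⊆ D′∩U-d d∈D′∩U , D′∩U-d)
                                  (c , d , x∈p∩q⁺ (c∈C′ , c∈U) , d∈D′∩U , e) ⟩
      wsum w (C′ ∩ U)   ≤⟨ w∩U≤w′ C′ (λ v∈C′ → componentOf-∁ G-conn attached C′-c v∈C′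
                                                  (full (componentOf-⊆ C′-c v∈C′))) ⟩
      wsum w′ C′        ∎
      where
      open ℚ.≤-Reasoning
      C′-c = component⇒componentOf C′-comp c∈C′
      D′-d = component⇒componentOf D′-comp d∈D′
      c∈S′ = componentOf-⊆ C′-c c∈C′
      endpoints = crossing-edge-inside full meets c∈S′ (x∈p─q⇒x∉q (componentOf-⊆ D′-d d∈D′)) e
      c∈U = proj₁ endpoints
      d∈U = proj₂ endpoints
      d∈D′∩U = x∈p∩q⁺ (d∈D′ , d∈U)
      c∈S = subst (c ∈_) S′∩U≡S (x∈p∩q⁺ (c∈S′ , c∈U))
      C′∩U-c : IsComponentOf G S c (C′ ∩ U)
      C′∩U-c = subst (λ X → IsComponentOf G X c (C′ ∩ U)) S′∩U≡S (componentOf-∩ attached C′-c c∈U)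
      D′∩U-d : IsComponentOf G (U ─ S) d (D′ ∩ U)
      D′∩U-d = subst (λ X → IsComponentOf G X d (D′ ∩ U))
                     (trans (⊤─p∩q≡q─p∩q S′ U) (cong (U ─_) S′∩U≡S))
                     (componentOf-∩ attached D′-d d∈U)

  lift-safe : ∀ S → IsSafe G U w S → ∃[ S′ ] (IsSafe G ⊤ w′ S′ × wsum w′ S′ ≤ wsum w S)
  lift-safe S S-safe@(S⊆U , _) with v ∈? S
  ... | yes v∈S = S ∪ ∁ U ,
    lift-safe-saturated S∪∁U∩U≡S (λ _ → q⊆p∪q S (∁ U)) (λ _ _ → p⊆p∪q (∁ U) v∈S) S-safe
    where
    S∪∁U∩U⊆S : ∀ {y} → y ∈ S ⊎ y ∈ ∁ U → y ∈ U → y ∈ S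
    S∪∁U∩U⊆S (inj₁ y∈S)  _   = y∈S
    S∪∁U∩U⊆S (inj₂ y∈∁U) y∈U = contradiction y∈U (x∈∁p⇒x∉p y∈∁U)
    S∪∁U∩U≡S : (S ∪ ∁ U) ∩ U ≡ S
    S∪∁U∩U≡S = ⊆-antisym (λ y∈ → S∪∁U∩U⊆S (x∈p∪q⁻ S (∁ U) (p∩q⊆p _ U y∈)) (p∩q⊆q _ U y∈))
                         (λ y∈S → x∈p∩q⁺ (p⊆p∪q (∁ U) y∈S , S⊆U y∈S))
  ... | no v∉S = S ,
    lift-safe-saturated S∩U≡S (λ v∈S → contradiction v∈S v∉S)
                        (λ y∈S y∉U → contradiction (S⊆U y∈S) y∉U) S-safe
    where
    S∩U≡S : S ∩ U ≡ S
    S∩U≡S = ⊆-antisym (p∩q⊆p S U) (λ y∈S → x∈p∩q⁺ (y∈S , S⊆U y∈S))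

  ∩U-connSafe : ∀ {T} → IsConnSafe G ⊤ w′ T → Nonempty (T ∩ U) → IsConnSafe G U w (T ∩ U)
  ∩U-connSafe {T} ((_ , _ , T-safe) , T-conn) T∩U-ne@(t , t∈T∩U) =
    (p∩q⊆q T U , T∩U-ne , T∩U-safe) , T∩U-conn
    where
    T∩U-conn = connected-∩ attached T-conn T∩U-ne
    meets : ∀ {y} → y ∈ T → y ∉ U → v ∈ T
    meets = componentOf-exit attached (connected⇒componentOf T-conn (p∩q⊆p T U t∈T∩U))
                             (p∩q⊆q T U t∈T∩U)
    T∩U-safe : ∀ C D → IsComponent G (T ∩ U) C → IsComponent G (U ─ T ∩ U) D → Adjacent G C D →
               wsum w D ≤ wsum w C
    T∩U-safe C D C-comp D-comp (c , d , c∈C , d∈D , e) = begin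
      wsum w D         ≡⟨ cong (wsum w) E∩U≡D ⟨
      wsum w (E ∩ U)   ≤⟨ w∩U≤w′ E E-full ⟩
      wsum w′ E        ≤⟨ T-safe T E (connected⇒component T-conn) (d , d∈⊤─T , E-d)
                                (c , d , p∩q⊆p T U c∈T∩U , componentOf-∋ E-d d∈⊤─T , e) ⟩
      wsum w′ T        ≤⟨ w′≤w∩U T meets ⟩
      wsum w (T ∩ U)   ≡⟨ cong (wsum w) C≡T∩U ⟨
      wsum w C         ∎
      where
      open ℚ.≤-Reasoning
      C-c = component⇒componentOf C-comp c∈C
      c∈T∩U = componentOf-⊆ C-c c∈C
      C≡T∩U = componentOf-unique C-c (connected⇒componentOf T∩U-conn c∈T∩U)
      D-d = component⇒componentOf D-comp d∈D
      d∈U─T∩U = componentOf-⊆ D-d d∈D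
      d∈⊤─T = p∩q⊆p (⊤ ─ T) U (subst (d ∈_) (≡-sym (⊤─p∩q≡q─p∩q T U)) d∈U─T∩U)
      E = proj₁ (componentOf-exists G (⊤ ─ T) d d∈⊤─T)
      E-d = proj₂ (componentOf-exists G (⊤ ─ T) d d∈⊤─T)
      E∩U≡D : E ∩ U ≡ D
      E∩U≡D = componentOf-unique (subst (λ X → IsComponentOf G X d (E ∩ U)) (⊤─p∩q≡q─p∩q T U)
                                        (componentOf-∩ attached E-d (p─q⊆p U _ d∈U─T∩U))) D-d
      E-full : v ∈ E → ∁ U ⊆ E
      E-full v∈E = componentOf-∁ G-conn attached E-d v∈E λ r∈∁U →
        x∈p∧x∉q⇒x∈p─q ∈⊤ λ r∈T → x∈p─q⇒x∉q (componentOf-⊆ E-d v∈E) (meets r∈T (x∈∁p⇒x∉p r∈∁U))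

  w[U]≤w′[T]+ρ : ∀ {T} → IsConnSafe G ⊤ w′ T → ¬ Nonempty (T ∩ U) → wsum w U ≤ wsum w′ T + ρ
  w[U]≤w′[T]+ρ {T} ((_ , T-ne , T-safe) , T-conn) T∩U-empty = begin
    wsum w U          ≡⟨ wsum-w′-∈ (λ u∈U → u∈U) v∈U ⟨
    wsum w′ U + ρ     ≤⟨ +-monoˡ-≤ ρ (wsum-mono w′ w′≥0 U⊆Z) ⟩
    wsum w′ Z + ρ     ≤⟨ +-monoˡ-≤ ρ (T-safe T Z (connected⇒component T-conn) Z-comp
                                             (connected⇒adjacent G-conn T-ne Z-comp)) ⟩
    wsum w′ T + ρ     ∎
    where
    open ℚ.≤-Reasoning
    U⊆⊤─T : U ⊆ ⊤ ─ T
    U⊆⊤─T u∈U = x∈p∧x∉q⇒x∈p─q ∈⊤ λ u∈T → T∩U-empty (_ , x∈p∩q⁺ (u∈T , u∈U))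
    Z = proj₁ (componentOf-exists G (⊤ ─ T) v (U⊆⊤─T v∈U))
    Z-v = proj₂ (componentOf-exists G (⊤ ─ T) v (U⊆⊤─T v∈U))
    Z-comp : IsComponent G (⊤ ─ T) Z
    Z-comp = v , U⊆⊤─T v∈U , Z-v
    U⊆Z : U ⊆ Z
    U⊆Z u∈U = from (Z-v _) (Reach-mono G U⊆⊤─T (Reach-within G-conn attached v∈U u∈U))

  restrict-connSafe : ∀ T → IsConnSafe G ⊤ w′ T →
                      ∃[ T′ ] (IsConnSafe G U w T′ × wsum w T′ ≤ wsum w′ T + ρ)
  restrict-connSafe T T-cs with nonempty? (T ∩ U)
  ... | yes T∩U-ne   = T ∩ U , ∩U-connSafe T-cs T∩U-ne , w∩U≤w′+ρ T
  ... | no T∩U-empty = U , connected⇒connSafe w (connected-attached G-conn attached v∈U) ,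
                           w[U]≤w′[T]+ρ T-cs T∩U-empty

  s≡cs : InGcs G ⊤ → (∀ A B → wsum w A ≤ wsum w B + ρ → wsum w A ≤ wsum w B) →
         ∃[ m ] (IsSafeNumber G U w m × IsConnSafeNumber G U w m)
  s≡cs G∈Gcs absorb with G∈Gcs w′ (λ x _ → w′>0 x)
  ... | _ , (_ , T-min) , ((T , T-cs , refl) , _) with restrict-connSafe T T-cs
  ... | T′ , T′-cs , T′≤T+ρ = minimal-connSafe⇒s≡cs T′-cs λ S S-safe →
    let S′ , S′-safe , S′≤S = lift-safe S S-safe in
    absorb T′ S (begin
      wsum w T′        ≤⟨ T′≤T+ρ ⟩
      wsum w′ T + ρ    ≤⟨ +-monoˡ-≤ ρ (T-min S′ S′-safe) ⟩
      wsum w′ S′ + ρ   ≤⟨ +-monoˡ-≤ ρ S′≤S ⟩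
      wsum w S + ρ     ∎)
    where open ℚ.≤-Reasoning

InGcs-attached : ∀ {G : Graph n} {U v} → Connected G ⊤ → InGcs G ⊤ →
                 AttachedAt G U v → v ∈ U → InGcs G U
InGcs-attached {U = U} {v} G-conn G∈Gcs attached v∈U w w>0 =
  let δ , δ>0 , δ≤wv , absorb = wsum-gap w (w>0 v v∈U)
      ε , ε>0 , ρ<δ = uniform-weight< (∁ U) δ>0
  in Transfer.s≡cs G-conn attached v∈U w w>0 ε>0 (ℚ.<-≤-trans ρ<δ δ≤wv) G∈Gcs (absorb ρ<δ)

proposition2p5 : ∀ {n} (G : Graph n) (v : Fin n) →
    Connected G ⊤ → InGcs G ⊤ → IsCutVertex G v →
    ∀ (D : Subset n) → IsComponent G (⊤ - v) D → InGcs G (D ∪ ⁅ v ⁆)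
proposition2p5 G v G-conn G∈Gcs _ D D-comp =
  InGcs-attached G-conn G∈Gcs (component∪⁅v⁆-attached D-comp) (q⊆p∪q D ⁅ v ⁆ (x∈⁅x⁆ v))
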